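{- Let $P$ be a finite poset with $n\geq 2$ elements, let $a$ be a minimal element of $P$, and let $b\in P$ be such that $\pi_{a,b}$ is an order-preserving partition. Then for every linear extension $g$ of the poset $\pi_{a,b}$ there is a linear extension $f$ of $P$ such that $a\oplus_f 1=b$ and $f_a=g$.
   Context: A linear extension of an $m$-element poset $Q$ is an order-preserving bijection $Q\to\{0,\dots,m-1\}$; for a linear extension $f$ of $P$, $x\oplus_f k=f^{ -1}(f(x)\oplus k)$ with $\oplus$ addition modulo $n$. For distinct $a,b\in P$, $\pi_{a,b}=\{\{a,b\}\}\cup\{\{x\}:x\in P\setminus\{a,b\}\}$. A partition is order-preserving if it is the class partition of an order-congruence $\rho$ (an equivalence relation such that every $\rho$-circle — a sequence $x_0,\dots,x_m$, $x_0=x_m$, each step either within a $\rho$-class or strictly increasing — stays in one class); it is ordered by the quotient order $\rho[x]\leq\rho[y]$ iff there is such a step-sequence from $x$ to $y$. For a linear extension $f$ of $P$ and a minimal element $a$, with $c=a\oplus_f 1$, the map $f_a\colon\pi_{a,c}\to\{0,\dots,n-2\}$ is defined by $f_a(\{x\})=f(x)$ if $f(x)<f(a)$, $f_a(\{a,c\})=\min(f(a),f(c))$, and $f_a(\{x\})=f(x)-1$ if $f(x)>f(a)+1$. -}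

module Defs where

open import Level using (0ℓ)
open import Data.Nat using (ℕ; zero; suc; _+_; _∸_; _%_; _⊓_; _<ᵇ_; pred)
  renaming (_≤_ to _≤ℕ_)
open import Data.Fin using (Fin; toℕ; _≟_)
open import Data.Product using (_×_; Σ; ∃; _,_)
open import Data.Sum using (_⊎_)
open import Data.Bool using (if_then_else_)
open import Relation.Binary using (Rel; IsPartialOrder; IsEquivalence)
open import Relation.Binary.PropositionalEquality using (_≡_)
open import Relation.Nullary using (¬_; yes; no)
open import Function.Definitions using (Bijective)

-- residue modulo n (n is nonzero whenever Fin n is inhabited)
modN : ℕ → ℕ → ℕ
modN zero    k = k
modN (suc m) k = k % suc m

IsFinPoset : (n : ℕ) → Rel (Fin n) 0ℓ → Set
IsFinPoset n _≤P_ = IsPartialOrder _≡_ _≤P_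

module _ {n : ℕ} (_≤P_ : Rel (Fin n) 0ℓ) where

  _<P_ : Rel (Fin n) 0ℓ
  x <P y = x ≤P y × ¬ (x ≡ y)

  Minimal : Fin n → Set
  Minimal a = ∀ x → x ≤P a → x ≡ a

  IsLinearExtension : (Fin n → Fin n) → Set
  IsLinearExtension f =
    Bijective _≡_ _≡_ f × (∀ x y → x ≤P y → toℕ (f x) ≤ℕ toℕ (f y))

  -- x ⊕_f k = f⁻¹(f(x) ⊕ k); we express "x ⊕_f k = y" as f(y) = (f(x)+k) mod n
  PlusIs : (f : Fin n → Fin n) → Fin n → ℕ → Fin n → Set
  PlusIs f x k y = toℕ (f y) ≡ modN n (toℕ (f x) + k)

-- the equivalence relation whose classes form π_{a,b}
πRel : {n : ℕ} → Fin n → Fin n → Rel (Fin n) 0ℓ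
πRel a b x y = x ≡ y ⊎ ((x ≡ a × y ≡ b) ⊎ (x ≡ b × y ≡ a))

data Walk {A : Set} (R : Rel A 0ℓ) : A → A → Set where
  []  : ∀ {x} → Walk R x x
  _∷_ : ∀ {x y z} → R x y → Walk R y z → Walk R x z

data OnWalk {A : Set} {R : Rel A 0ℓ} (z : A) : {x y : A} → Walk R x y → Set where
  here-[] : OnWalk z {z} {z} []
  here    : ∀ {y w} (r : R z y) (ws : Walk R y w) → OnWalk z (r ∷ ws)
  there   : ∀ {x y w} (r : R x y) {ws : Walk R y w} → OnWalk z ws → OnWalk z (r ∷ ws)

module _ {n : ℕ} (_≤P_ : Rel (Fin n) 0ℓ) (ρ : Rel (Fin n) 0ℓ) where

  Step : Rel (Fin n) 0ℓ
  Step x y = ρ x y ⊎ _<P_ _≤P_ x y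

  IsOrderCongruence : Set
  IsOrderCongruence =
    IsEquivalence ρ ×
    (∀ x (c : Walk Step x x) → ∀ z → OnWalk z c → ρ x z)

  -- quotient order: ρ[x] ≤ ρ[y] iff there is a step-sequence from x to y
  _≤Q_ : Rel (Fin n) 0ℓ
  x ≤Q y = Walk Step x y

  -- A linear extension of the quotient poset P/ρ with m classes, represented
  -- as a map G : P → {0,…,m-1} which is constant on classes and induces a
  -- bijection P/ρ → {0,…,m-1} that is order preserving for the quotient order.
  IsQuotLinearExtension : (m : ℕ) → (Fin n → Fin m) → Set
  IsQuotLinearExtension m G =
    (∀ x y → ρ x y → G x ≡ G y) ×
    (∀ x y → G x ≡ G y → ρ x y) ×
    (∀ k → ∃ λ x → G x ≡ k) ×
    (∀ x y → x ≤Q y → toℕ (G x) ≤ℕ toℕ (G y))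

-- f_a on π_{a,c}, evaluated at the class of x (values in ℕ).
fa : {n : ℕ} → (Fin n → Fin n) → (a c : Fin n) → Fin n → ℕ
fa f a c x with x ≟ a | x ≟ c
... | yes _ | _     = toℕ (f a) ⊓ toℕ (f c)
... | no _  | yes _ = toℕ (f a) ⊓ toℕ (f c)
... | no _  | no _  = if toℕ (f x) <ᵇ toℕ (f a) then toℕ (f x) else toℕ (f x) ∸ 1

module Submission where

-- Put k = g(a) = g(b) and re-insert a in front of its class:
--   f(a) = k,   f(x) = punchIn k (g x)  for x ≠ a,
-- where punchIn k j is j below k and j+1 from k on (the order-preserving
-- injection {0,…,m-1} → {0,…,m} missing k).  Then f(b) = k+1, and deleting
-- the gap again (which is exactly what f_a does) gives back g.

open import Defs
open import Level using (0ℓ)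
open import Data.Nat using (ℕ; _≤_; pred)
open import Data.Fin using (Fin; toℕ)
open import Data.Product using (_×_; ∃)
open import Relation.Binary using (Rel)
open import Relation.Binary.PropositionalEquality using (_≡_)
open import Relation.Nullary using (¬_)

open import Data.Nat using (suc; _<_; _+_; _∸_; _⊓_; _<ᵇ_; s≤s; _<?_)
open import Data.Nat.Properties
  using (<⇒<ᵇ; <ᵇ⇒<; <⇒≱; ≮⇒≥; ≤-refl; ≤-trans; ≤-reflexive; n≤1+n; m≤n⇒m⊓n≡m; +-comm)
open import Data.Nat.DivMod using (m<n⇒m%n≡m)
open import Data.Fin using (inject₁; punchIn; punchOut; _≟_)
open import Data.Fin.Properties
  using (toℕ-inject₁; toℕ<n; punchIn-injective; punchInᵢ≢i; punchIn-mono-≤; punchIn-punchOut)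
open import Data.Product using (_,_; proj₁; proj₂)
open import Data.Sum using (inj₁; inj₂)
open import Data.Bool using (true; false; if_then_else_)
open import Data.Empty using (⊥-elim)
open import Function.Definitions using (Injective; Surjective; Bijective)
open import Relation.Nullary using (yes; no)
open import Relation.Binary.PropositionalEquality using (refl; sym; trans; cong; subst; _≢_; module ≡-Reasoning)

if-< : ∀ {A : Set} m n {x y : A} → m < n → (if m <ᵇ n then x else y) ≡ x
if-< m n m<n with m <ᵇ n | <⇒<ᵇ m<n
... | true  | _ = refl
... | false | ()

if-≥ : ∀ {A : Set} m n {x y : A} → n ≤ m → (if m <ᵇ n then x else y) ≡ y
if-≥ m n n≤m with m <ᵇ n | <ᵇ⇒< m n
... | true  | m<n = ⊥-elim (<⇒≱ (m<n _) n≤m)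
... | false | _   = refl

punchIn-below : ∀ {m} (i : Fin (suc m)) (j : Fin m) → toℕ j < toℕ i →
  toℕ (punchIn i j) ≡ toℕ j
punchIn-below (Fin.suc i) Fin.zero    _         = refl
punchIn-below (Fin.suc i) (Fin.suc j) (s≤s j<i) = cong suc (punchIn-below i j j<i)

punchIn-above : ∀ {m} (i : Fin (suc m)) (j : Fin m) → toℕ i ≤ toℕ j →
  toℕ (punchIn i j) ≡ suc (toℕ j)
punchIn-above Fin.zero    j           _         = refl
punchIn-above (Fin.suc i) (Fin.suc j) (s≤s i≤j) = cong suc (punchIn-above i j i≤j)

punchIn-pivot-≤ : ∀ {m} (i : Fin (suc m)) (j : Fin m) → toℕ i ≤ toℕ j →
  toℕ i ≤ toℕ (punchIn i j)
punchIn-pivot-≤ i j i≤j =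
  ≤-trans i≤j (≤-trans (n≤1+n _) (≤-reflexive (sym (punchIn-above i j i≤j))))

close-gap-punchIn : ∀ {m} (i : Fin (suc m)) (j : Fin m) →
  (if toℕ (punchIn i j) <ᵇ toℕ i then toℕ (punchIn i j) else toℕ (punchIn i j) ∸ 1)
    ≡ toℕ j
close-gap-punchIn i j with toℕ j <? toℕ i
... | yes j<i rewrite punchIn-below i j j<i = if-< (toℕ j) (toℕ i) j<i
... | no  j≮i rewrite punchIn-above i j (≮⇒≥ j≮i) =
  if-≥ (suc (toℕ j)) (toℕ i) (≤-trans (≮⇒≥ j≮i) (n≤1+n _))

module InsertAt {m : ℕ} (g : Fin (suc m) → Fin m) (a : Fin (suc m)) where

  pivot : Fin (suc m)
  pivot = inject₁ (g a)

  insert : Fin (suc m) → Fin (suc m)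
  insert x with x ≟ a
  ... | yes _ = pivot
  ... | no  _ = punchIn pivot (g x)

  insert-at : insert a ≡ pivot
  insert-at with a ≟ a
  ... | yes _   = refl
  ... | no  a≢a = ⊥-elim (a≢a refl)

  insert-at-value : toℕ (insert a) ≡ toℕ (g a)
  insert-at-value = trans (cong toℕ insert-at) (toℕ-inject₁ (g a))

  insert-off : ∀ {x} → x ≢ a → insert x ≡ punchIn pivot (g x)
  insert-off {x} x≢a with x ≟ a
  ... | yes x≡a = ⊥-elim (x≢a x≡a)
  ... | no  _   = refl

  -- If g only identifies points different from a trivially, insert is
  -- injective: the slot pivot is missed by punchIn pivot, and punchIn is
  -- injective.
  insert-injective : (∀ {x y} → x ≢ a → y ≢ a → g x ≡ g y → x ≡ y) →
    Injective _≡_ _≡_ insert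
  insert-injective g-inj {x} {y} eq with x ≟ a | y ≟ a
  ... | yes x≡a | yes y≡a = trans x≡a (sym y≡a)
  ... | yes _   | no _    = ⊥-elim (punchInᵢ≢i pivot (g y) (sym eq))
  ... | no _    | yes _   = ⊥-elim (punchInᵢ≢i pivot (g x) eq)
  ... | no x≢a  | no y≢a  = g-inj x≢a y≢a (punchIn-injective pivot (g x) (g y) eq)

  -- If g is onto and a shares its value with some b ≠ a, insert is onto:
  -- the slot pivot is hit by a, every other slot by a preimage under g of
  -- the value obtained after closing the gap (replaced by b if that is a).
  insert-surjective : Surjective _≡_ _≡_ g → ∀ b → b ≢ a → g b ≡ g a →
    Surjective _≡_ _≡_ insert
  insert-surjective g-onto b b≢a gb≡ga j with pivot ≟ j
  ... | yes refl = a , λ { refl → insert-at }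
  ... | no pivot≢j with g-onto (punchOut pivot≢j)
  ...   | x , gx≡ = hit , λ { refl → hits }
    where
    hits-via : ∀ {y} → y ≢ a → g y ≡ punchOut pivot≢j → insert y ≡ j
    hits-via y≢a gy≡ =
      trans (insert-off y≢a) (trans (cong (punchIn pivot) gy≡) (punchIn-punchOut pivot≢j))
    hit : Fin (suc m)
    hit with x ≟ a
    ... | yes _ = b
    ... | no  _ = x
    hits : insert hit ≡ j
    hits with x ≟ a
    ... | yes refl = hits-via b≢a (trans gb≡ga (gx≡ refl))
    ... | no  x≢a  = hits-via x≢a (gx≡ refl)

  -- For a minimal a and g monotone on strictly comparable pairs, insert is
  -- order preserving: a goes to the bottom of its class, everything else
  -- is shifted monotonically by punchIn.
  insert-monotone : (_≤P_ : Rel (Fin (suc m)) 0ℓ) → Minimal _≤P_ a →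
    (∀ x y → x ≤P y → x ≢ y → toℕ (g x) ≤ toℕ (g y)) →
    ∀ x y → x ≤P y → toℕ (insert x) ≤ toℕ (insert y)
  insert-monotone _≤P_ a-min g-mono x y x≤y with x ≟ a | y ≟ a
  ... | yes _    | yes _   = ≤-refl
  ... | no x≢a   | yes y≡a = ⊥-elim (x≢a (a-min x (subst (x ≤P_) y≡a x≤y)))
  ... | yes refl | no y≢a  =
    punchIn-pivot-≤ pivot (g y)
      (≤-trans (≤-reflexive (toℕ-inject₁ (g a))) (g-mono a y x≤y (λ a≡y → y≢a (sym a≡y))))
  ... | no _     | no _ with x ≟ y
  ...   | yes refl = ≤-refl
  ...   | no x≢y   = punchIn-mono-≤ pivot (g x) (g y) (g-mono x y x≤y x≢y)

  insert-partner : ∀ {b} → b ≢ a → g b ≡ g a → toℕ (insert b) ≡ suc (toℕ (insert a))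
  insert-partner {b} b≢a gb≡ga = begin
    toℕ (insert b)             ≡⟨ cong toℕ (insert-off b≢a) ⟩
    toℕ (punchIn pivot (g b))  ≡⟨ punchIn-above pivot (g b) pivot≤gb ⟩
    suc (toℕ (g b))            ≡⟨ cong (λ i → suc (toℕ i)) gb≡ga ⟩
    suc (toℕ (g a))            ≡⟨ cong suc (sym insert-at-value) ⟩
    suc (toℕ (insert a))       ∎
    where
    open ≡-Reasoning
    pivot≤gb : toℕ pivot ≤ toℕ (g b)
    pivot≤gb = ≤-reflexive (trans (toℕ-inject₁ (g a)) (cong toℕ (sym gb≡ga)))

  insert-merged-class : ∀ {b} → b ≢ a → g b ≡ g a →
    toℕ (insert a) ⊓ toℕ (insert b) ≡ toℕ (g a)
  insert-merged-class b≢a gb≡ga rewrite insert-partner b≢a gb≡ga =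
    trans (m≤n⇒m⊓n≡m (n≤1+n _)) insert-at-value

  insert-merge : ∀ {b} → b ≢ a → g b ≡ g a → ∀ x → fa insert a b x ≡ toℕ (g x)
  insert-merge {b} b≢a gb≡ga x with x ≟ a | x ≟ b
  ... | yes refl | _        = insert-merged-class b≢a gb≡ga
  ... | no _     | yes refl = trans (insert-merged-class b≢a gb≡ga) (cong toℕ (sym gb≡ga))
  ... | no x≢a   | no _
    rewrite insert-at | insert-off x≢a = close-gap-punchIn pivot (g x)

module QuotientExtension {n m : ℕ} (_≤P_ : Rel (Fin n) 0ℓ) (a b : Fin n)
  (g : Fin n → Fin m) (g-ext : IsQuotLinearExtension _≤P_ (πRel a b) m g) where

  same-class : g b ≡ g a
  same-class = proj₁ g-ext b a (inj₂ (inj₂ (refl , refl)))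

  -- Away from a, the classes are singletons, so g separates points.
  injective-off : ∀ {x y} → x ≢ a → y ≢ a → g x ≡ g y → x ≡ y
  injective-off x≢a y≢a gx≡gy with proj₁ (proj₂ g-ext) _ _ gx≡gy
  ... | inj₁ x≡y              = x≡y
  ... | inj₂ (inj₁ (x≡a , _)) = ⊥-elim (x≢a x≡a)
  ... | inj₂ (inj₂ (_ , y≡a)) = ⊥-elim (y≢a y≡a)

  surjective : Surjective _≡_ _≡_ g
  surjective k with proj₁ (proj₂ (proj₂ g-ext)) k
  ... | x , gx≡k = x , λ { refl → gx≡k }

  -- A strict comparison x < y is a one-step walk in the quotient order.
  monotone-strict : ∀ x y → x ≤P y → x ≢ y → toℕ (g x) ≤ toℕ (g y)
  monotone-strict x y x≤y x≢y = proj₂ (proj₂ (proj₂ g-ext)) x y (inj₂ (x≤y , x≢y) ∷ [])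

successor-mod : ∀ {m} (k : Fin m) → suc (toℕ k) ≡ modN (suc m) (toℕ k + 1)
successor-mod k rewrite +-comm (toℕ k) 1 = sym (m<n⇒m%n≡m (s≤s (toℕ<n k)))

lemma25 : (n : ℕ) → 2 ≤ n → (_≤P_ : Rel (Fin n) 0ℓ) → IsFinPoset n _≤P_ →
    (a b : Fin n) → Minimal _≤P_ a → ¬ (a ≡ b) →
    IsOrderCongruence _≤P_ (πRel a b) →
    (g : Fin n → Fin (pred n)) → IsQuotLinearExtension _≤P_ (πRel a b) (pred n) g →
    ∃ λ (f : Fin n → Fin n) → IsLinearExtension _≤P_ f × PlusIs _≤P_ f a 1 b ×
    (∀ x → fa f a b x ≡ toℕ (g x))
lemma25 (suc m) _ _≤P_ _ a b a-min a≢b _ g g-ext =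
  insert , (bijective , insert-monotone _≤P_ a-min monotone-strict) , plus-one , insert-merge b≢a same-class
  where
  open InsertAt g a
  open QuotientExtension _≤P_ a b g g-ext
  b≢a : b ≢ a
  b≢a b≡a = a≢b (sym b≡a)
  bijective : Bijective _≡_ _≡_ insert
  bijective = insert-injective injective-off , insert-surjective surjective b b≢a same-class
  plus-one : PlusIs _≤P_ insert a 1 b
  plus-one rewrite insert-partner b≢a same-class | insert-at-value = successor-mod (g a)
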